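{- Let $q=p^r$ with $p$ prime and $r$ a positive integer. If $u,v,w,x\in\mathbb{F}_{q^2}$ satisfy $u^{q-1}+v^{q-1}+w^{q-1}+x^{q-1}=0$, then $uvwx$ is a square in $\mathbb{F}_{q^2}$.
   Context: $\mathbb{F}_{q^2}$ is the finite field with $q^2$ elements. -}

module Defs where

open import Level using (Level)
open import Algebra.Bundles using (CommutativeRing; Semiring)
open import Data.Nat using (ℕ)
open import Data.Fin using (Fin)
open import Data.Product using (∃; _×_)
open import Relation.Nullary using (¬_)
open import Function.Bundles using (Bijection)
import Relation.Binary.PropositionalEquality as ≡
import Algebra.Definitions.RawSemiring as RS

IsField : ∀ {c ℓ} → CommutativeRing c ℓ → Set _
IsField F = ¬ (1# ≈ 0#) × (∀ x → ¬ (x ≈ 0#) → ∃ λ y → x * y ≈ 1#)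
  where open CommutativeRing F

HasCardinality : ∀ {c ℓ} → CommutativeRing c ℓ → ℕ → Set _
HasCardinality F n = Bijection (≡.setoid (Fin n)) (CommutativeRing.setoid F)

pow : ∀ {c ℓ} (F : CommutativeRing c ℓ) → CommutativeRing.Carrier F → ℕ → CommutativeRing.Carrier F
pow F = RS._^_ (Semiring.rawSemiring (CommutativeRing.semiring F))

IsSquare : ∀ {c ℓ} (F : CommutativeRing c ℓ) → CommutativeRing.Carrier F → Set _
IsSquare F z = ∃ λ y → y * y ≈ z
  where open CommutativeRing F

{-# OPTIONS --safe #-}
module Submission where

-- If q is even, every element of F is a square: z = z^(q²) = (z^(q²/2))².
-- If q is odd, the values a = u^(q-1), b, c, d of nonzero u, v, w, x satisfy a^(q+1) = 1, so
-- a^q = a⁻¹, and applying the Frobenius map x ↦ x^q to a + b + c + d = 0 shows that their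
-- inverses sum to zero as well. These two relations force abcd = (ab)² or abcd = (ac)², the
-- square of an element s with s^(q+1) = 1. Hence z = uvwx satisfies
-- z^((q²-1)/2) = (z^(q-1))^((q+1)/2) = s^(q+1) = 1, and by Euler's criterion z is a square.

open import Defs
open import Algebra.Bundles using (CommutativeRing; CommutativeSemiring; RawRing)
open import Data.Nat as ℕ using (ℕ; zero; suc; NonZero; _≤_; _<_; z≤n; s≤s)
import Data.Nat.Properties as ℕ
open import Data.Nat.Combinatorics using (_C_; nCn≡1; nC1≡n; nCk+nC[k+1]≡[n+1]C[k+1])
open import Data.Nat.Divisibility using (_∣_; divides; ∣⇒≤)
open import Data.Nat.Primality using (Prime; euclidsLemma; prime⇒nonZero)
open import Data.Nat.Solver using (module +-*-Solver)
open import Data.Fin as Fin using (Fin; punchIn)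
import Data.Fin.Properties as Fin
open import Data.Fin.Permutation as Permutation using (Permutation; _⟨$⟩ʳ_)
open import Data.Vec using (Vec; []; _∷_)
open import Data.Vec.Functional using (tail; init; last)
open import Data.Maybe using (Maybe; just; nothing)
open import Data.Product using (∃; _,_; proj₁; proj₂)
import Data.Product as Product
open import Data.Sum using (_⊎_; inj₁; inj₂)
open import Function using (Inverse; Congruent; Bijection)
open import Function.Properties.Bijection using (Bijection⇒Inverse)
import Function.Construct.Composition as Composition
import Function.Construct.Symmetry as Symmetry
open import Relation.Nullary using (¬_; Dec; yes; no; contradiction)
open import Relation.Binary.Definitions using (Decidable)
import Relation.Binary.PropositionalEquality as ≡
open ≡ using (_≡_; _≢_)
open import Algebra.Solver.Ring.AlmostCommutativeRing using (fromCommutativeRing; _-Raw-AlmostCommutative⟶_)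

module CommutativeRingSolver {c ℓ} (R : CommutativeRing c ℓ) where
  open CommutativeRing R
  open import Algebra.Properties.Ring ring using (x[y-z]≈xy-xz; [y-z]x≈yx-zx)
  open import Algebra.Properties.Group +-group using (ε⁻¹≈ε)
  open import Algebra.Properties.AbelianGroup +-abelianGroup using (⁻¹-∙-comm; ⁻¹-anti-homo‿-)
  open import Algebra.Properties.CommutativeSemigroup +-commutativeSemigroup using (interchange)
  open import Algebra.Properties.Semiring.Mult semiring using (_×_; ×-homo-+; ×-homo-1; ×1-homo-*; ×-congˡ)
  open import Relation.Binary.Reasoning.Setoid setoid

  -- The ring solver needs coefficients with computable equality: integers, as formal differences of naturals.
  ℤ-rawRing : RawRing _ _
  ℤ-rawRing = record
    { Carrier = ℕ Product.× ℕ
    ; _≈_     = _≡_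
    ; _+_     = λ { (a , b) (c , d) → (a ℕ.+ c , b ℕ.+ d) }
    ; _*_     = λ { (a , b) (c , d) → (a ℕ.* c ℕ.+ b ℕ.* d , a ℕ.* d ℕ.+ b ℕ.* c) }
    ; -_      = λ { (a , b) → (b , a) }
    ; 0#      = (0 , 0)
    ; 1#      = (1 , 0)
    }

  ⟦_⟧ : ℕ Product.× ℕ → Carrier
  ⟦ a , b ⟧ = a × 1# - b × 1#

  [x+z]-[y+w]≈[x-y]+[z-w] : ∀ x y z w → (x + z) - (y + w) ≈ (x - y) + (z - w)
  [x+z]-[y+w]≈[x-y]+[z-w] x y z w = begin
    (x + z) - (y + w)       ≈⟨ +-congˡ (⁻¹-∙-comm y w) ⟨
    (x + z) + (- y + - w)   ≈⟨ interchange x z (- y) (- w) ⟩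
    (x - y) + (z - w)       ∎

  [x-y][z-w]≈[xz+yw]-[xw+yz] : ∀ x y z w → (x - y) * (z - w) ≈ (x * z + y * w) - (x * w + y * z)
  [x-y][z-w]≈[xz+yw]-[xw+yz] x y z w = begin
    (x - y) * (z - w)                          ≈⟨ [y-z]x≈yx-zx (z - w) x y ⟩
    x * (z - w) - y * (z - w)                  ≈⟨ +-cong (x[y-z]≈xy-xz x z w) (-‿cong (x[y-z]≈xy-xz y z w)) ⟩
    (x * z - x * w) - (y * z - y * w)          ≈⟨ +-congˡ (⁻¹-anti-homo‿- (y * z) (y * w)) ⟩
    (x * z - x * w) + (y * w - y * z)          ≈⟨ interchange (x * z) (- (x * w)) (y * w) (- (y * z)) ⟩
    (x * z + y * w) + (- (x * w) + - (y * z))  ≈⟨ +-congˡ (⁻¹-∙-comm (x * w) (y * z)) ⟩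
    (x * z + y * w) - (x * w + y * z)          ∎

  [x+z]-[y+z]≈x-y : ∀ x y z → (x + z) - (y + z) ≈ x - y
  [x+z]-[y+z]≈x-y x y z = begin
    (x + z) - (y + z)   ≈⟨ [x+z]-[y+w]≈[x-y]+[z-w] x y z z ⟩
    (x - y) + (z - z)   ≈⟨ +-congˡ (-‿inverseʳ z) ⟩
    (x - y) + 0#        ≈⟨ +-identityʳ (x - y) ⟩
    x - y               ∎

  ⟦⟧-homomorphism : ℤ-rawRing -Raw-AlmostCommutative⟶ fromCommutativeRing R
  ⟦⟧-homomorphism = record
    { ⟦_⟧    = ⟦_⟧
    ; +-homo = λ { (a , b) (c , d) → trans (+-cong (×-homo-+ 1# a c) (-‿cong (×-homo-+ 1# b d)))
                                           ([x+z]-[y+w]≈[x-y]+[z-w] _ _ _ _) }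
    ; *-homo = λ { (a , b) (c , d) → trans (+-cong (×-sum-of-products a c b d) (-‿cong (×-sum-of-products a d b c)))
                                           (sym ([x-y][z-w]≈[xz+yw]-[xw+yz] _ _ _ _)) }
    ; -‿homo = λ { (a , b) → sym (⁻¹-anti-homo‿- (a × 1#) (b × 1#)) }
    ; 0-homo = -‿inverseʳ 0#
    ; 1-homo = trans (+-cong (×-homo-1 1#) ε⁻¹≈ε) (+-identityʳ 1#)
    }
    where
    ×-sum-of-products : ∀ a b c d → (a ℕ.* b ℕ.+ c ℕ.* d) × 1# ≈ (a × 1#) * (b × 1#) + (c × 1#) * (d × 1#)
    ×-sum-of-products a b c d = trans (×-homo-+ 1# (a ℕ.* b) (c ℕ.* d)) (+-cong (×1-homo-* a b) (×1-homo-* c d))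

  ⟦⟧-equal? : ∀ x y → Maybe (⟦ x ⟧ ≈ ⟦ y ⟧)
  ⟦⟧-equal? (a , b) (c , d) with a ℕ.+ d ℕ.≟ c ℕ.+ b
  ... | no _  = nothing
  ... | yes e = just (begin
    a × 1# - b × 1#                        ≈⟨ [x+z]-[y+z]≈x-y (a × 1#) (b × 1#) (d × 1#) ⟨
    (a × 1# + d × 1#) - (b × 1# + d × 1#)  ≈⟨ +-cong (sym (×-homo-+ 1# a d)) (-‿cong (+-comm _ _)) ⟩
    (a ℕ.+ d) × 1# - (d × 1# + b × 1#)     ≈⟨ +-congʳ (trans (×-congˡ e) (×-homo-+ 1# c b)) ⟩
    (c × 1# + b × 1#) - (d × 1# + b × 1#)  ≈⟨ [x+z]-[y+z]≈x-y (c × 1#) (d × 1#) (b × 1#) ⟩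
    c × 1# - d × 1#                        ∎)

  open import Algebra.Solver.Ring ℤ-rawRing (fromCommutativeRing R) ⟦⟧-homomorphism ⟦⟧-equal? public
    using (solve; _:=_; _:+_; _:*_; _:-_; :-_)

module Arithmetic where
  open import Data.Nat using (_+_; _*_)
  open ≡ using (refl; cong; cong₂; trans; sym)

  odd⊎even : ∀ n .{{_ : NonZero n}} → ∃ λ k → n ≡ suc (k * 2) ⊎ n ≡ suc k * 2
  odd⊎even 1 = 0 , inj₁ refl
  odd⊎even (suc (suc n)) with odd⊎even (suc n)
  ... | k , inj₁ 1+n≡2k+1 = k , inj₂ (cong suc 1+n≡2k+1)
  ... | k , inj₂ 1+n≡2k+2 = suc k , inj₁ (cong suc 1+n≡2k+2)

  [k+1]*[n+1]C[k+1]≡[n+1]*nCk : ∀ n k → suc k * (suc n C suc k) ≡ suc n * (n C k)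
  [k+1]*[n+1]C[k+1]≡[n+1]*nCk zero    zero    = refl
  [k+1]*[n+1]C[k+1]≡[n+1]*nCk zero    (suc k) = ℕ.*-zeroʳ (suc (suc k))
  [k+1]*[n+1]C[k+1]≡[n+1]*nCk (suc n) zero    =
    trans (ℕ.*-identityˡ _) (trans (nC1≡n (suc (suc n))) (sym (ℕ.*-identityʳ _)))
  [k+1]*[n+1]C[k+1]≡[n+1]*nCk (suc n) (suc k) = begin
    suc (suc k) * (suc (suc n) C suc (suc k))
      ≡⟨ cong (suc (suc k) *_) (nCk+nC[k+1]≡[n+1]C[k+1] (suc n) (suc k)) ⟨
    suc (suc k) * (A + B)
      ≡⟨ solve 3 (λ k A B → (con 2 :+ k) :* (A :+ B) := A :+ ((con 1 :+ k) :* A :+ (con 2 :+ k) :* B)) refl k A B ⟩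
    A + (suc k * A + suc (suc k) * B)
      ≡⟨ cong (A +_) (cong₂ _+_ ([k+1]*[n+1]C[k+1]≡[n+1]*nCk n k) ([k+1]*[n+1]C[k+1]≡[n+1]*nCk n (suc k))) ⟩
    A + (suc n * (n C k) + suc n * (n C suc k))
      ≡⟨ cong (A +_) (ℕ.*-distribˡ-+ (suc n) (n C k) (n C suc k)) ⟨
    A + suc n * (n C k + n C suc k)
      ≡⟨ cong (λ m → A + suc n * m) (nCk+nC[k+1]≡[n+1]C[k+1] n k) ⟩
    A + suc n * A
      ∎
    where
    open ≡.≡-Reasoning
    open +-*-Solver
    A = suc n C suc k
    B = suc n C suc (suc k)

  prime∣pCk : ∀ {p k} → Prime p → 0 < k → k < p → p ∣ p C k
  prime∣pCk {suc n} {suc k} p-prime _ k<p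
    with euclidsLemma (suc k) (suc n C suc k) p-prime
           (divides (n C k) (trans ([k+1]*[n+1]C[k+1]≡[n+1]*nCk n k) (ℕ.*-comm (suc n) (n C k))))
  ... | inj₁ p∣k+1 = contradiction (∣⇒≤ p∣k+1) (ℕ.<⇒≱ k<p)
  ... | inj₂ p∣pCk = p∣pCk

open Arithmetic

module Frobenius {c ℓ} (S : CommutativeSemiring c ℓ) where
  open CommutativeSemiring S
  open import Algebra.Properties.CommutativeSemiring.Binomial S using (theorem; binomialExpansion; binomialTerm)
  open import Algebra.Properties.Semiring.Sum semiring using (sum; sum-init-last; sum-cong-≋; sum-replicate-zero)
  open import Algebra.Properties.Semiring.Mult semiring using (_×_; ×-homo-1; ×-assoc-*; ×1-homo-*; ×-congˡ; ×-congʳ)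
  open import Algebra.Properties.Semiring.Exp semiring using (_^_; ^-congˡ; ^-congʳ; ^-assocʳ)
  open import Relation.Binary.Reasoning.Setoid setoid

  binomialExpansion-sparse : ∀ n .{{_ : NonZero n}} x y →
    (∀ k w → 0 < k → k < n → (n C k) × w ≈ 0#) →
    binomialExpansion x y n ≈ x ^ n + y ^ n
  binomialExpansion-sparse (suc n) x y middle≈0 = begin
    t Fin.zero + sum (tail t)                          ≈⟨ +-cong first (sum-init-last (tail t)) ⟩
    y ^ suc n + (sum (init (tail t)) + last (tail t))  ≈⟨ +-congˡ (+-cong middle (final (Fin.toℕ-fromℕ n))) ⟩
    y ^ suc n + (0# + x ^ suc n)                       ≈⟨ +-congˡ (+-identityˡ _) ⟩
    y ^ suc n + x ^ suc n                              ≈⟨ +-comm _ _ ⟩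
    x ^ suc n + y ^ suc n                              ∎
    where
    t = binomialTerm x y (suc n)
    first : t Fin.zero ≈ y ^ suc n
    first = trans (×-homo-1 _) (*-identityˡ _)
    -- Stated for any k ≡ n, since the index of the last term is toℕ (fromℕ n).
    final : ∀ {k} → k ≡ n → (suc n C suc k) × (x ^ suc k * y ^ (n ℕ.∸ k)) ≈ x ^ suc n
    final ≡.refl = begin
      (suc n C suc n) × (x ^ suc n * y ^ (n ℕ.∸ n))  ≈⟨ ×-congˡ (nCn≡1 (suc n)) ⟩
      1 × (x ^ suc n * y ^ (n ℕ.∸ n))                ≈⟨ ×-homo-1 _ ⟩
      x ^ suc n * y ^ (n ℕ.∸ n)                      ≈⟨ *-congˡ (^-congʳ y (ℕ.n∸n≡0 n)) ⟩
      x ^ suc n * 1#                                 ≈⟨ *-identityʳ _ ⟩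
      x ^ suc n                                      ∎
    middle : sum (init (tail t)) ≈ 0#
    middle = trans (sum-cong-≋ (λ j → middle≈0 _ _ (s≤s z≤n) (s≤s (Fin.inject₁ℕ< j)))) (sum-replicate-zero n)

  module _ {p} (p-prime : Prime p) (char : p × 1# ≈ 0#) where

    p∣m⇒m×x≈0 : ∀ {m} x → p ∣ m → m × x ≈ 0#
    p∣m⇒m×x≈0 x (divides q ≡.refl) = begin
      (q ℕ.* p) × x             ≈⟨ ×-congʳ (q ℕ.* p) (*-identityˡ x) ⟨
      (q ℕ.* p) × (1# * x)      ≈⟨ ×-assoc-* (q ℕ.* p) 1# x ⟨
      ((q ℕ.* p) × 1#) * x      ≈⟨ *-congʳ (×1-homo-* q p) ⟩
      ((q × 1#) * (p × 1#)) * x ≈⟨ *-congʳ (*-congˡ char) ⟩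
      ((q × 1#) * 0#) * x       ≈⟨ *-congʳ (zeroʳ _) ⟩
      0# * x                    ≈⟨ zeroˡ x ⟩
      0#                        ∎

    frobenius : ∀ x y → (x + y) ^ p ≈ x ^ p + y ^ p
    frobenius x y = trans (theorem p x y)
      (binomialExpansion-sparse p {{prime⇒nonZero p-prime}} x y
        (λ k w 0<k k<p → p∣m⇒m×x≈0 w (prime∣pCk p-prime 0<k k<p)))

    frobenius-^ : ∀ r x y → (x + y) ^ (p ℕ.^ r) ≈ x ^ (p ℕ.^ r) + y ^ (p ℕ.^ r)
    frobenius-^ zero x y = distribʳ 1# x y
    frobenius-^ (suc r) x y = begin
      (x + y) ^ (p ℕ.* p ℕ.^ r)                   ≈⟨ ^-assocʳ (x + y) p (p ℕ.^ r) ⟨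
      ((x + y) ^ p) ^ (p ℕ.^ r)                   ≈⟨ ^-congˡ (p ℕ.^ r) (frobenius x y) ⟩
      (x ^ p + y ^ p) ^ (p ℕ.^ r)                 ≈⟨ frobenius-^ r (x ^ p) (y ^ p) ⟩
      (x ^ p) ^ (p ℕ.^ r) + (y ^ p) ^ (p ℕ.^ r)   ≈⟨ +-cong (^-assocʳ x p (p ℕ.^ r)) (^-assocʳ y p (p ℕ.^ r)) ⟩
      x ^ (p ℕ.* p ℕ.^ r) + y ^ (p ℕ.* p ℕ.^ r)   ∎

module FieldProperties {c ℓ} (F : CommutativeRing c ℓ) (isField : IsField F) where
  open CommutativeRing F
  open CommutativeRingSolver F
  open import Algebra.Properties.Ring ring using (x[y-z]≈xy-xz; -‿distribˡ-*)
  open import Algebra.Properties.Group +-group using (x∙y⁻¹≈ε⇒x≈y; inverseˡ-unique; inverseʳ-unique)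
  open import Algebra.Properties.CommutativeSemigroup *-commutativeSemigroup using (xy∙z≈y∙xz; interchange)
  open import Algebra.Properties.Semiring.Exp semiring using (_^_; ^-assocʳ)
  open import Algebra.Properties.CommutativeMonoid.Sum *-commutativeMonoid using () renaming (sum to product)
  open import Relation.Binary.Reasoning.Setoid setoid

  1≉0 : ¬ 1# ≈ 0#
  1≉0 = proj₁ isField

  xy≈0⇒y≈0 : ∀ {x y} → ¬ x ≈ 0# → x * y ≈ 0# → y ≈ 0#
  xy≈0⇒y≈0 {x} {y} x≉0 xy≈0 = begin
    y                ≈⟨ *-identityˡ y ⟨
    1# * y           ≈⟨ *-congʳ xx⁻¹≈1 ⟨
    (x * x⁻¹) * y    ≈⟨ xy∙z≈y∙xz x x⁻¹ y ⟩
    x⁻¹ * (x * y)    ≈⟨ *-congˡ xy≈0 ⟩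
    x⁻¹ * 0#         ≈⟨ zeroʳ x⁻¹ ⟩
    0#               ∎
    where
    x⁻¹ = proj₁ (proj₂ isField x x≉0)
    xx⁻¹≈1 = proj₂ (proj₂ isField x x≉0)

  *-≉0 : ∀ {x y} → ¬ x ≈ 0# → ¬ y ≈ 0# → ¬ x * y ≈ 0#
  *-≉0 x≉0 y≉0 xy≈0 = y≉0 (xy≈0⇒y≈0 x≉0 xy≈0)

  ^-≉0 : ∀ {x} n → ¬ x ≈ 0# → ¬ x ^ n ≈ 0#
  ^-≉0 zero    x≉0 = 1≉0
  ^-≉0 (suc n) x≉0 = *-≉0 x≉0 (^-≉0 n x≉0)

  xy≉0⇒x≉0 : ∀ {x y} → ¬ x * y ≈ 0# → ¬ x ≈ 0#
  xy≉0⇒x≉0 {x} {y} xy≉0 x≈0 = xy≉0 (trans (*-congʳ x≈0) (zeroˡ y))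

  xy≉0⇒y≉0 : ∀ {x y} → ¬ x * y ≈ 0# → ¬ y ≈ 0#
  xy≉0⇒y≉0 {x} {y} xy≉0 y≈0 = xy≉0 (trans (*-congˡ y≈0) (zeroʳ x))

  x≉y⇒x-y≉0 : ∀ {x y} → ¬ x ≈ y → ¬ x - y ≈ 0#
  x≉y⇒x-y≉0 x≉y x-y≈0 = x≉y (x∙y⁻¹≈ε⇒x≈y _ _ x-y≈0)

  *-cancelˡ : ∀ {x y z} → ¬ x ≈ 0# → x * y ≈ x * z → y ≈ z
  *-cancelˡ {x} {y} {z} x≉0 xy≈xz = x∙y⁻¹≈ε⇒x≈y y z (xy≈0⇒y≈0 x≉0 (begin
    x * (y - z)      ≈⟨ x[y-z]≈xy-xz x y z ⟩
    x * y - x * z    ≈⟨ +-congʳ xy≈xz ⟩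
    x * z - x * z    ≈⟨ -‿inverseʳ (x * z) ⟩
    0#               ∎))

  *-cancelʳ : ∀ {x y z} → ¬ x ≈ 0# → y * x ≈ z * x → y ≈ z
  *-cancelʳ {x} {y} {z} x≉0 yx≈zx = *-cancelˡ x≉0 (trans (*-comm x y) (trans yx≈zx (*-comm z x)))

  product-≉0 : ∀ {k} (f : Fin k → Carrier) → (∀ i → ¬ f i ≈ 0#) → ¬ product f ≈ 0#
  product-≉0 {zero}  f f≉0 = 1≉0
  product-≉0 {suc k} f f≉0 = *-≉0 (f≉0 Fin.zero) (product-≉0 (λ i → f (Fin.suc i)) (λ i → f≉0 (Fin.suc i)))

  x^[n*2]≈x^n*x^n : ∀ x n → x ^ (n ℕ.* 2) ≈ x ^ n * x ^ n
  x^[n*2]≈x^n*x^n x n = trans (sym (^-assocʳ x n 2)) (*-congˡ (*-identityʳ (x ^ n)))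

  automorphism : (f g : Carrier → Carrier) → Congruent _≈_ _≈_ f → Congruent _≈_ _≈_ g →
                 (∀ x → f (g x) ≈ x) → (∀ x → g (f x) ≈ x) → Inverse setoid setoid
  automorphism f g f-cong g-cong fg≈id gf≈id = record
    { to        = f
    ; from      = g
    ; to-cong   = f-cong
    ; from-cong = g-cong
    ; inverse   = (λ {x} y≈gx → trans (f-cong y≈gx) (fg≈id x)) , (λ {x} y≈fx → trans (g-cong y≈fx) (gf≈id x))
    }

  +-translation : Carrier → Inverse setoid setoid
  +-translation a = automorphism (_+ a) (_- a) +-congʳ +-congʳ
    (λ x → solve 2 (λ x a → (x :- a) :+ a := x) refl x a)
    (λ x → solve 2 (λ x a → (x :+ a) :- a := x) refl x a)

  *-scaling : ∀ {a} → ¬ a ≈ 0# → Inverse setoid setoid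
  *-scaling {a} a≉0 = automorphism (a *_) (a⁻¹ *_) *-congˡ *-congˡ
    (λ x → trans (sym (*-assoc a a⁻¹ x)) (trans (*-congʳ aa⁻¹≈1) (*-identityˡ x)))
    (λ x → trans (sym (*-assoc a⁻¹ a x)) (trans (*-congʳ (trans (*-comm a⁻¹ a) aa⁻¹≈1)) (*-identityˡ x)))
    where
    a⁻¹ = proj₁ (proj₂ isField a a≉0)
    aa⁻¹≈1 = proj₂ (proj₂ isField a a≉0)

  inverse-* : ∀ {a b a′ b′} → a * a′ ≈ 1# → b * b′ ≈ 1# → (a * b) * (a′ * b′) ≈ 1#
  inverse-* {a} {b} {a′} {b′} aa′≈1 bb′≈1 = begin
    (a * b) * (a′ * b′)   ≈⟨ interchange a b a′ b′ ⟩
    (a * a′) * (b * b′)   ≈⟨ *-cong aa′≈1 bb′≈1 ⟩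
    1# * 1#               ≈⟨ *-identityʳ 1# ⟩
    1#                    ∎

  inverse-+ : ∀ {a b a′ b′} → a * a′ ≈ 1# → b * b′ ≈ 1# → (a + b) * (a′ * b′) ≈ a′ + b′
  inverse-+ {a} {b} {a′} {b′} aa′≈1 bb′≈1 = begin
    (a + b) * (a′ * b′)
      ≈⟨ solve 4 (λ a b a′ b′ → (a :+ b) :* (a′ :* b′) := b′ :* (a :* a′) :+ a′ :* (b :* b′)) refl a b a′ b′ ⟩
    b′ * (a * a′) + a′ * (b * b′)     ≈⟨ +-cong (*-congˡ aa′≈1) (*-congˡ bb′≈1) ⟩
    b′ * 1# + a′ * 1#                 ≈⟨ +-cong (*-identityʳ b′) (*-identityʳ a′) ⟩
    b′ + a′                           ≈⟨ +-comm b′ a′ ⟩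
    a′ + b′                           ∎

  -- Either a + b = 0 = c + d, or dividing a + b = -(c + d) by 1/a + 1/b = -(1/c + 1/d),
  -- that is (a + b)/ab = -(c + d)/cd, gives ab = cd.
  product-of-four-units : ∀ {a b c d a′ b′ c′ d′} →
    a * a′ ≈ 1# → b * b′ ≈ 1# → c * c′ ≈ 1# → d * d′ ≈ 1# →
    a + b + c + d ≈ 0# → a′ + b′ + c′ + d′ ≈ 0# → Dec (a + b ≈ 0#) →
    a * b * c * d ≈ (a * b) * (a * b) ⊎ a * b * c * d ≈ (a * c) * (a * c)
  product-of-four-units {a} {b} {c} {d} {a′} {b′} {c′} {d′} aa′≈1 bb′≈1 cc′≈1 dd′≈1 Σ≈0 Σ′≈0 (yes a+b≈0) =
    inj₂ (begin
      a * b * c * d           ≈⟨ *-cong (*-congʳ (*-congˡ (inverseʳ-unique a b a+b≈0))) (inverseʳ-unique c d c+d≈0) ⟩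
      a * (- a) * c * (- c)   ≈⟨ solve 2 (λ a c → a :* (:- a) :* c :* (:- c) := (a :* c) :* (a :* c)) refl a c ⟩
      (a * c) * (a * c)       ∎)
    where
    c+d≈0 : c + d ≈ 0#
    c+d≈0 = begin
      c + d               ≈⟨ +-identityˡ (c + d) ⟨
      0# + (c + d)        ≈⟨ +-congʳ a+b≈0 ⟨
      (a + b) + (c + d)   ≈⟨ +-assoc (a + b) c d ⟨
      a + b + c + d       ≈⟨ Σ≈0 ⟩
      0#                  ∎
  product-of-four-units {a} {b} {c} {d} {a′} {b′} {c′} {d′} aa′≈1 bb′≈1 cc′≈1 dd′≈1 Σ≈0 Σ′≈0 (no a+b≉0) =
    inj₁ (begin
      a * b * c * d       ≈⟨ *-assoc (a * b) c d ⟩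
      (a * b) * (c * d)   ≈⟨ *-congˡ ab≈cd ⟨
      (a * b) * (a * b)   ∎)
    where
    a′b′≈c′d′ : a′ * b′ ≈ c′ * d′
    a′b′≈c′d′ = *-cancelˡ a+b≉0 (begin
      (a + b) * (a′ * b′)       ≈⟨ inverse-+ aa′≈1 bb′≈1 ⟩
      a′ + b′                   ≈⟨ inverseˡ-unique (a′ + b′) (c′ + d′) (trans (sym (+-assoc (a′ + b′) c′ d′)) Σ′≈0) ⟩
      - (c′ + d′)               ≈⟨ -‿cong (inverse-+ cc′≈1 dd′≈1) ⟨
      - ((c + d) * (c′ * d′))   ≈⟨ -‿distribˡ-* (c + d) (c′ * d′) ⟩
      - (c + d) * (c′ * d′)     ≈⟨ *-congʳ (inverseˡ-unique (a + b) (c + d) (trans (sym (+-assoc (a + b) c d)) Σ≈0)) ⟨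
      (a + b) * (c′ * d′)       ∎)
    ab≈cd : a * b ≈ c * d
    ab≈cd = *-cancelʳ (λ a′b′≈0 → 1≉0 (trans (sym (inverse-* aa′≈1 bb′≈1)) (trans (*-congˡ a′b′≈0) (zeroʳ _)))) (begin
      (a * b) * (a′ * b′)   ≈⟨ inverse-* aa′≈1 bb′≈1 ⟩
      1#                    ≈⟨ inverse-* cc′≈1 dd′≈1 ⟨
      (c * d) * (c′ * d′)   ≈⟨ *-congˡ a′b′≈c′d′ ⟨
      (c * d) * (a′ * b′)   ∎)

module MonicPolynomials {c ℓ} (F : CommutativeRing c ℓ) (isField : IsField F) where
  open CommutativeRing F
  open CommutativeRingSolver F
  open FieldProperties F isField using (1≉0; xy≈0⇒y≈0; x≉y⇒x-y≉0)
  open import Relation.Binary.Reasoning.Setoid setoid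

  -- c₀ ∷ c₁ ∷ … ∷ c_{d-1} stands for the monic polynomial Y^d + c_{d-1} Y^(d-1) + … + c₁ Y + c₀.
  evalMonic : ∀ {d} → Vec Carrier d → Carrier → Carrier
  evalMonic []       y = 1#
  evalMonic (c ∷ cs) y = c + y * evalMonic cs y

  divideByRoot : ∀ {d} → Carrier → Vec Carrier (suc d) → Vec Carrier d
  divideByRoot a (c ∷ [])         = []
  divideByRoot a (c ∷ cs@(_ ∷ _)) = evalMonic cs a ∷ divideByRoot a cs

  evalMonic-divideByRoot : ∀ {d} a (cs : Vec Carrier (suc d)) y →
    evalMonic cs y ≈ evalMonic cs a + (y - a) * evalMonic (divideByRoot a cs) y
  evalMonic-divideByRoot a (c ∷ []) y =
    solve 4 (λ a c y o → c :+ y :* o := (c :+ a :* o) :+ (y :- a) :* o) refl a c y 1#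
  evalMonic-divideByRoot a (c ∷ cs@(_ ∷ _)) y = begin
    c + y * evalMonic cs y
      ≈⟨ +-congˡ (*-congˡ (evalMonic-divideByRoot a cs y)) ⟩
    c + y * (A + (y - a) * Q)
      ≈⟨ solve 5 (λ c y a A Q → c :+ y :* (A :+ (y :- a) :* Q) := (c :+ a :* A) :+ (y :- a) :* (A :+ y :* Q)) refl c y a A Q ⟩
    (c + a * A) + (y - a) * (A + y * Q)
      ∎
    where
    A = evalMonic cs a
    Q = evalMonic (divideByRoot a cs) y

  monic-roots≤degree : ∀ {d k} (cs : Vec Carrier d) (root : Fin k → Carrier) →
    (∀ {i j} → root i ≈ root j → i ≡ j) → (∀ i → evalMonic cs (root i) ≈ 0#) → k ≤ d
  monic-roots≤degree {k = zero} _ _ _ _ = z≤n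
  monic-roots≤degree {k = suc k} [] _ _ isRoot = contradiction (isRoot Fin.zero) 1≉0
  monic-roots≤degree {k = suc k} cs@(_ ∷ _) root injective isRoot =
    s≤s (monic-roots≤degree (divideByRoot a cs) (λ i → root (Fin.suc i))
          (λ e → Fin.suc-injective (injective e)) isQuotientRoot)
    where
    a = root Fin.zero
    isQuotientRoot : ∀ i → evalMonic (divideByRoot a cs) (root (Fin.suc i)) ≈ 0#
    isQuotientRoot i = xy≈0⇒y≈0 (x≉y⇒x-y≉0 (λ e → Fin.0≢1+n (injective (sym e)))) (begin
      (b - a) * evalMonic (divideByRoot a cs) b                 ≈⟨ +-identityˡ _ ⟨
      0# + (b - a) * evalMonic (divideByRoot a cs) b            ≈⟨ +-congʳ (isRoot Fin.zero) ⟨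
      evalMonic cs a + (b - a) * evalMonic (divideByRoot a cs) b ≈⟨ evalMonic-divideByRoot a cs b ⟨
      evalMonic cs b                                            ≈⟨ isRoot (Fin.suc i) ⟩
      0#                                                        ∎)
      where b = root (Fin.suc i)

module FiniteField {c ℓ} (F : CommutativeRing c ℓ) (isField : IsField F)
                   {n : ℕ} (card : HasCardinality F (suc n)) where
  open CommutativeRing F
  open CommutativeRingSolver F
  open FieldProperties F isField
  open MonicPolynomials F isField
  open import Algebra.Properties.Group +-group using (∙-cancelˡ)
  open import Algebra.Properties.Semiring.Exp semiring using (_^_; ^-congʳ)
  open import Algebra.Properties.Semiring.Mult semiring using (_×_; ×1-homo-*; ×-congˡ)
  import Algebra.Properties.CommutativeMonoid.Sum +-commutativeMonoid as Additive
  import Algebra.Properties.CommutativeMonoid.Sum *-commutativeMonoid as Multiplicative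
  open import Relation.Binary.Reasoning.Setoid setoid

  private
    N = suc n

  enumeration : Inverse (≡.setoid (Fin N)) setoid
  enumeration = Bijection⇒Inverse card

  open Inverse enumeration using () renaming (to to element; from to index)

  element-index : ∀ x → element (index x) ≈ x
  element-index = Inverse.strictlyInverseˡ enumeration

  index-element : ∀ i → index (element i) ≡ i
  index-element = Inverse.strictlyInverseʳ enumeration

  index-cong : ∀ {x y} → x ≈ y → index x ≡ index y
  index-cong = Inverse.from-cong enumeration

  infix 4 _≟_
  _≟_ : Decidable _≈_
  x ≟ y with index x Fin.≟ index y
  ... | yes i≡j = yes (trans (sym (element-index x)) (trans (reflexive (≡.cong element i≡j)) (element-index y)))
  ... | no  i≢j = no (λ x≈y → i≢j (index-cong x≈y))

  element-injective : ∀ {i j} → element i ≈ element j → i ≡ j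
  element-injective = Bijection.injective card

  n≢0 : n ≢ 0
  n≢0 ≡.refl = 1≉0 (trans (sym (element-index 1#)) (trans (reflexive (≡.cong element (all-equal _ _))) (element-index 0#)))
    where
    all-equal : (i j : Fin 1) → i ≡ j
    all-equal Fin.zero Fin.zero = ≡.refl

  permutationOf : Inverse setoid setoid → Permutation N N
  permutationOf σ = Composition.inverse (Composition.inverse enumeration σ) (Symmetry.inverse enumeration)

  element-permutationOf : ∀ σ i → element (permutationOf σ ⟨$⟩ʳ i) ≈ Inverse.to σ (element i)
  element-permutationOf σ i = element-index _

  cardinality×1≈0 : N × 1# ≈ 0#
  cardinality×1≈0 = ∙-cancelˡ S (N × 1#) 0# (begin
    S + N × 1#                                 ≈⟨ +-congˡ (Additive.sum-replicate N {1#}) ⟨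
    S + Additive.sum {N} (λ _ → 1#)           ≈⟨ Additive.∑-distrib-+ element (λ _ → 1#) ⟨
    Additive.sum (λ i → element i + 1#)        ≈⟨ Additive.sum-cong-≋ (element-permutationOf (+-translation 1#)) ⟨
    Additive.sum (λ i → element (π ⟨$⟩ʳ i))    ≈⟨ Additive.sum-permute element π ⟨
    S                                          ≈⟨ +-identityʳ S ⟨
    S + 0#                                     ∎)
    where
    S = Additive.sum element
    π = permutationOf (+-translation 1#)

  nonzeroElement : Fin n → Carrier
  nonzeroElement j = element (punchIn (index 0#) j)

  nonzeroElement-≉0 : ∀ j → ¬ nonzeroElement j ≈ 0#
  nonzeroElement-≉0 j e = Fin.punchInᵢ≢i (index 0#) j (≡.trans (≡.sym (index-element _)) (index-cong e))

  fermat : ∀ {y} → ¬ y ≈ 0# → y ^ n ≈ 1#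
  fermat {y} y≉0 = *-cancelʳ (product-≉0 nonzeroElement nonzeroElement-≉0) (begin
    y ^ n * P                                                ≈⟨ *-congʳ (Multiplicative.sum-replicate n {y}) ⟨
    Multiplicative.sum {n} (λ _ → y) * P                     ≈⟨ Multiplicative.∑-distrib-+ (λ _ → y) nonzeroElement ⟨
    Multiplicative.sum (λ j → y * nonzeroElement j)          ≈⟨ Multiplicative.sum-cong-≋ (λ j → element-permutationOf σ (punchIn o j)) ⟨
    Multiplicative.sum (λ j → element (π ⟨$⟩ʳ punchIn o j))   ≈⟨ Multiplicative.sum-cong-≋ (λ j → reflexive (≡.cong element (π-punchIn j))) ⟩
    Multiplicative.sum (λ j → nonzeroElement (π₀ ⟨$⟩ʳ j))     ≈⟨ Multiplicative.sum-permute nonzeroElement π₀ ⟨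
    P                                                        ≈⟨ *-identityˡ P ⟨
    1# * P                                                   ∎)
    where
    o = index 0#
    P = Multiplicative.sum nonzeroElement
    σ = *-scaling y≉0
    π = permutationOf σ
    π₀ = Permutation.remove o π
    πo≡o : π ⟨$⟩ʳ o ≡ o
    πo≡o = index-cong (trans (*-congˡ (element-index 0#)) (zeroʳ y))
    π-punchIn : ∀ j → π ⟨$⟩ʳ punchIn o j ≡ punchIn o (π₀ ⟨$⟩ʳ j)
    π-punchIn j = ≡.trans (Permutation.punchIn-permute π o j) (≡.cong (λ i → punchIn i (π₀ ⟨$⟩ʳ j)) πo≡o)

  x^[1+n]≈x : ∀ x → x ^ N ≈ x
  x^[1+n]≈x x with x ≟ 0#
  ... | yes x≈0 = trans (*-congʳ x≈0) (trans (zeroˡ _) (sym x≈0))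
  ... | no  x≉0 = trans (*-congˡ (fermat x≉0)) (*-identityʳ x)

  x^e≈0⇒x≈0 : ∀ {x} e → x ^ e ≈ 0# → x ≈ 0#
  x^e≈0⇒x≈0 {x} e x^e≈0 with x ≟ 0#
  ... | yes x≈0 = x≈0
  ... | no  x≉0 = contradiction x^e≈0 (^-≉0 e x≉0)

  characteristic : ∀ m e → N ≡ m ℕ.^ e → m × 1# ≈ 0#
  characteristic m e N≡mᵉ = x^e≈0⇒x≈0 e (begin
    (m × 1#) ^ e    ≈⟨ ×1-homo-^ e ⟨
    (m ℕ.^ e) × 1#  ≈⟨ ×-congˡ N≡mᵉ ⟨
    N × 1#          ≈⟨ cardinality×1≈0 ⟩
    0#              ∎)
    where
    ×1-homo-^ : ∀ e → (m ℕ.^ e) × 1# ≈ (m × 1#) ^ e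
    ×1-homo-^ zero    = +-identityʳ 1#
    ×1-homo-^ (suc e) = trans (×1-homo-* m (m ℕ.^ e)) (*-congˡ (×1-homo-^ e))

  squares-of-even-order : ∀ h → N ≡ h ℕ.* 2 → ∀ z → IsSquare F z
  squares-of-even-order h N≡2h z = z ^ h , (begin
    z ^ h * z ^ h   ≈⟨ x^[n*2]≈x^n*x^n z h ⟨
    z ^ (h ℕ.* 2)   ≈⟨ ^-congʳ z N≡2h ⟨
    z ^ N           ≈⟨ x^[1+n]≈x z ⟩
    z               ∎)

  eulerPolynomial : Carrier → ∀ m → Vec Carrier (suc (m ℕ.* 2))
  eulerPolynomial z zero    = 0# ∷ []
  eulerPolynomial z (suc m) = 0# ∷ z ^ suc m ∷ eulerPolynomial z m

  eulerPolynomial-spec : ∀ z m y →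
    (y * y - z) * evalMonic (eulerPolynomial z m) y ≈ y ^ suc (suc m ℕ.* 2) - z ^ suc m * y
  eulerPolynomial-spec z zero y = begin
    (y * y - z) * (0# + y * 1#)
      ≈⟨ *-congˡ (+-identityˡ _) ⟩
    (y * y - z) * (y * 1#)
      ≈⟨ solve 3 (λ y z o → (y :* y :- z) :* (y :* o) := y :* (y :* (y :* o)) :- (z :* o) :* y) refl y z 1# ⟩
    y ^ 3 - z ^ 1 * y
      ∎
  eulerPolynomial-spec z (suc m) y = begin
    (y * y - z) * (0# + y * (Z + y * G))
      ≈⟨ *-congˡ (+-identityˡ _) ⟩
    (y * y - z) * (y * (Z + y * G))
      ≈⟨ solve 4 (λ y z Z G → (y :* y :- z) :* (y :* (Z :+ y :* G)) :=
                               (y :* y :- z) :* y :* Z :+ y :* y :* ((y :* y :- z) :* G)) refl y z Z G ⟩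
    (y * y - z) * y * Z + y * y * ((y * y - z) * G)
      ≈⟨ +-congˡ (*-congˡ (eulerPolynomial-spec z m y)) ⟩
    (y * y - z) * y * Z + y * y * (y * T - Z * y)
      ≈⟨ solve 4 (λ y z Z T → (y :* y :- z) :* y :* Z :+ y :* y :* (y :* T :- Z :* y) :=
                               y :* (y :* (y :* T)) :- (z :* Z) :* y) refl y z Z T ⟩
    y * (y * (y * T)) - (z * Z) * y
      ∎
    where
    Z = z ^ suc m
    G = evalMonic (eulerPolynomial z m) y
    T = y ^ (suc m ℕ.* 2)

  -- If z^(n/2) = 1 but z is not a square, every element is a root of eulerPolynomial, which has too small a degree.
  euler-criterion : ∀ m → n ≡ m ℕ.* 2 → ∀ z → z ^ m ≈ 1# → IsSquare F z
  euler-criterion zero    n≡0 z _ = contradiction n≡0 n≢0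
  euler-criterion (suc m) n≡2m z zᵐ≈1 with Fin.any? (λ i → element i * element i ≟ z)
  ... | yes square = element (proj₁ square) , proj₂ square
  ... | no ¬square = contradiction (monic-roots≤degree (eulerPolynomial z m) element element-injective isRoot) N≰2m+1
    where
    N≰2m+1 : ¬ N ≤ suc (m ℕ.* 2)
    N≰2m+1 N≤2m+1 = ℕ.<⇒≱ (ℕ.m<n+m (suc (m ℕ.* 2)) {2} (s≤s z≤n)) (≡.subst (λ k → suc k ≤ suc (m ℕ.* 2)) n≡2m N≤2m+1)
    isRoot : ∀ i → evalMonic (eulerPolynomial z m) (element i) ≈ 0#
    isRoot i = xy≈0⇒y≈0 (x≉y⇒x-y≉0 (λ e → ¬square (i , e))) (begin
      (y * y - z) * evalMonic (eulerPolynomial z m) y  ≈⟨ eulerPolynomial-spec z m y ⟩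
      y ^ suc (suc m ℕ.* 2) - z ^ suc m * y            ≈⟨ +-cong (^-congʳ y (≡.cong suc (≡.sym n≡2m))) (-‿cong (*-congʳ zᵐ≈1)) ⟩
      y ^ N - 1# * y                                   ≈⟨ +-cong (x^[1+n]≈x y) (-‿cong (*-identityˡ y)) ⟩
      y - y                                            ≈⟨ -‿inverseʳ y ⟩
      0#                                               ∎)
      where y = element i

module OddOrder {ℓ₁ ℓ₂} (F : CommutativeRing ℓ₁ ℓ₂) (isField : IsField F)
                (p r k : ℕ) (p-prime : Prime p) (q≡2k+1 : p ℕ.^ r ≡ suc (k ℕ.* 2))
                (card : HasCardinality F ((p ℕ.^ r) ℕ.^ 2)) where
  open CommutativeRing F
  open FieldProperties F isField
  open import Algebra.Properties.Semiring.Exp semiring using (_^_; ^-congʳ; ^-congˡ; ^-assocʳ)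
  open import Algebra.Properties.CommutativeSemiring.Exp commutativeSemiring using (^-distrib-*)
  open import Relation.Binary.Reasoning.Setoid setoid

  private
    q = suc (k ℕ.* 2)

  [2k+1]²≡1+2k[2k+2] : q ℕ.^ 2 ≡ suc ((k ℕ.* 2) ℕ.* (suc k ℕ.* 2))
  [2k+1]²≡1+2k[2k+2] = solve 1 (λ k → (con 1 :+ k :* con 2) :^ 2 := con 1 :+ (k :* con 2) :* ((con 1 :+ k) :* con 2)) ≡.refl k
    where open +-*-Solver

  open FiniteField F isField (≡.subst (HasCardinality F) (≡.trans (≡.cong (ℕ._^ 2) q≡2k+1) [2k+1]²≡1+2k[2k+2]) card)

  frobenius-q : ∀ x y → (x + y) ^ q ≈ x ^ q + y ^ q
  frobenius-q x y = ≡.subst (λ e → (x + y) ^ e ≈ x ^ e + y ^ e) q≡2k+1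
    (Frobenius.frobenius-^ commutativeSemiring p-prime (characteristic p (r ℕ.* 2) N≡p^2r) r x y)
    where
    N≡p^2r = ≡.trans (≡.sym [2k+1]²≡1+2k[2k+2]) (≡.trans (≡.cong (ℕ._^ 2) (≡.sym q≡2k+1)) (ℕ.^-*-assoc p r 2))

  sum-of-q-powers : ∀ {a b c d} → a + b + c + d ≈ 0# → a ^ q + b ^ q + c ^ q + d ^ q ≈ 0#
  sum-of-q-powers {a} {b} {c} {d} Σ≈0 = begin
    a ^ q + b ^ q + c ^ q + d ^ q   ≈⟨ +-congʳ (+-congʳ (frobenius-q a b)) ⟨
    (a + b) ^ q + c ^ q + d ^ q     ≈⟨ +-congʳ (frobenius-q (a + b) c) ⟨
    (a + b + c) ^ q + d ^ q         ≈⟨ frobenius-q (a + b + c) d ⟨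
    (a + b + c + d) ^ q             ≈⟨ ^-congˡ q Σ≈0 ⟩
    0# ^ q                          ≈⟨ zeroˡ _ ⟩
    0#                              ∎

  -- The elements of norm one over the subfield of order q; a^q is the inverse of such an a.
  NormOne : Carrier → Set ℓ₂
  NormOne a = a ^ suc q ≈ 1#

  ^[q-1]-normOne : ∀ {u} → ¬ u ≈ 0# → NormOne (u ^ (k ℕ.* 2))
  ^[q-1]-normOne {u} u≉0 = trans (^-assocʳ u (k ℕ.* 2) (suc q)) (fermat u≉0)

  normOne-* : ∀ {a b} → NormOne a → NormOne b → NormOne (a * b)
  normOne-* {a} {b} Na Nb = trans (^-distrib-* a b (suc q)) (trans (*-cong Na Nb) (*-identityʳ 1#))

  z^[q-1]≈s²⇒z^[n/2]≈1 : ∀ {z s} → z ^ (k ℕ.* 2) ≈ s * s → NormOne s → z ^ ((k ℕ.* 2) ℕ.* suc k) ≈ 1#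
  z^[q-1]≈s²⇒z^[n/2]≈1 {z} {s} z^[q-1]≈s² Ns = begin
    z ^ ((k ℕ.* 2) ℕ.* suc k)   ≈⟨ ^-assocʳ z (k ℕ.* 2) (suc k) ⟨
    (z ^ (k ℕ.* 2)) ^ suc k     ≈⟨ ^-congˡ (suc k) z^[q-1]≈s² ⟩
    (s * s) ^ suc k             ≈⟨ ^-distrib-* s s (suc k) ⟩
    s ^ suc k * s ^ suc k       ≈⟨ x^[n*2]≈x^n*x^n s (suc k) ⟨
    s ^ suc q                   ≈⟨ Ns ⟩
    1#                          ∎

  isSquare : ∀ u v w x →
    u ^ (p ℕ.^ r ℕ.∸ 1) + v ^ (p ℕ.^ r ℕ.∸ 1) + w ^ (p ℕ.^ r ℕ.∸ 1) + x ^ (p ℕ.^ r ℕ.∸ 1) ≈ 0# →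
    IsSquare F (u * v * w * x)
  isSquare u v w x Σ≈0 with u * v * w * x ≟ 0#
  ... | yes z≈0 = 0# , trans (zeroˡ 0#) (sym z≈0)
  ... | no  z≉0 = euler-criterion ((k ℕ.* 2) ℕ.* suc k) (≡.sym (ℕ.*-assoc (k ℕ.* 2) (suc k) 2)) (u * v * w * x)
                    (z^[n/2]≈1 (product-of-four-units Nu Nv Nw Nx Σ′≈0 (sum-of-q-powers Σ′≈0) (a + b ≟ 0#)))
    where
    a = u ^ (k ℕ.* 2)
    b = v ^ (k ℕ.* 2)
    c = w ^ (k ℕ.* 2)
    d = x ^ (k ℕ.* 2)
    Σ′≈0 : a + b + c + d ≈ 0#
    Σ′≈0 = ≡.subst (λ e → u ^ e + v ^ e + w ^ e + x ^ e ≈ 0#) (≡.cong (ℕ._∸ 1) q≡2k+1) Σ≈0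
    Nu = ^[q-1]-normOne (xy≉0⇒x≉0 (xy≉0⇒x≉0 (xy≉0⇒x≉0 z≉0)))
    Nv = ^[q-1]-normOne (xy≉0⇒y≉0 (xy≉0⇒x≉0 (xy≉0⇒x≉0 z≉0)))
    Nw = ^[q-1]-normOne (xy≉0⇒y≉0 (xy≉0⇒x≉0 z≉0))
    Nx = ^[q-1]-normOne (xy≉0⇒y≉0 z≉0)
    z^[q-1]≈abcd : (u * v * w * x) ^ (k ℕ.* 2) ≈ a * b * c * d
    z^[q-1]≈abcd = trans (^-distrib-* (u * v * w) x e) (*-congʳ (trans (^-distrib-* (u * v) w e) (*-congʳ (^-distrib-* u v e))))
      where e = k ℕ.* 2
    z^[n/2]≈1 : a * b * c * d ≈ (a * b) * (a * b) ⊎ a * b * c * d ≈ (a * c) * (a * c) →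
                      (u * v * w * x) ^ ((k ℕ.* 2) ℕ.* suc k) ≈ 1#
    z^[n/2]≈1 (inj₁ abcd≈[ab]²) = z^[q-1]≈s²⇒z^[n/2]≈1 (trans z^[q-1]≈abcd abcd≈[ab]²) (normOne-* Nu Nv)
    z^[n/2]≈1 (inj₂ abcd≈[ac]²) = z^[q-1]≈s²⇒z^[n/2]≈1 (trans z^[q-1]≈abcd abcd≈[ac]²) (normOne-* Nu Nw)

squares-of-even-square-order : ∀ {c ℓ} (F : CommutativeRing c ℓ) → IsField F →
  ∀ k {q} → q ≡ ℕ.suc k ℕ.* 2 → HasCardinality F (q ℕ.^ 2) → ∀ z → IsSquare F z
squares-of-even-square-order F isField k ≡.refl card =
  FiniteField.squares-of-even-order F isField card (q ℕ.* ℕ.suc k)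
    (≡.trans (≡.cong (q ℕ.*_) (ℕ.*-identityʳ q)) (≡.sym (ℕ.*-assoc q (ℕ.suc k) 2)))
  where q = ℕ.suc k ℕ.* 2

open import Data.Nat using (_^_; _∸_; _≥_)

corollary6 : ∀ {c ℓ} (F : CommutativeRing c ℓ) → IsField F →
    (p r : ℕ) → Prime p → r ≥ 1 → HasCardinality F ((p ^ r) ^ 2) →
    let open CommutativeRing F in
    (u v w x : Carrier) →
    pow F u ((p ^ r) ∸ 1) + pow F v ((p ^ r) ∸ 1) + pow F w ((p ^ r) ∸ 1) + pow F x ((p ^ r) ∸ 1) ≈ 0# →
    IsSquare F (u * v * w * x)
corollary6 F isField p r p-prime _ card u v w x Σ≈0
  with odd⊎even (p ^ r) {{ℕ.m^n≢0 p r {{prime⇒nonZero p-prime}}}}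
... | k , inj₁ q≡2k+1 = OddOrder.isSquare F isField p r k p-prime q≡2k+1 card u v w x Σ≈0
... | k , inj₂ q≡2k+2 = squares-of-even-square-order F isField k q≡2k+2 card (u * v * w * x)
  where open CommutativeRing F using (_*_)
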